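{- Consider the binary decision diagram setting below. Let $\eta=\langle k,l,u\rangle$ be a node with variable $v_\eta$, and let $k'<k$ and $l'=l+\sum_{i=k'}^{k-1}a_i$ be such that the Boolean functions $\sum_{i=k}^na_ib_i\le u$ and $\sum_{i=k'}^na_ib_i\le u$ are equivalent. Then there is a cutting planes derivation consisting of $6(k-k')+3$ steps that derives, from the defining constraints of $\langle k,l,u\rangle$ with variable $v_\eta$, the defining constraints for $\langle k',l',u\rangle$ with variable $v_\eta$.
   Context: Variables are Boolean, $\bar x=1-x$. Let $\sum_{i=1}^na_ib_i$ have positive integer coefficients $a_i$ and distinct literals $b_i$. For a node $\langle k,l,u\rangle$ (standing for $\sum_{i=k}^na_ib_i\le[l,u]$) with variable $v$, its defining constraints are $\big((\sum_{i=k}^na_i)-l\big)\bar v-\sum_{i=k}^na_ib_i\ge -l$ (i.e. $v\Rightarrow\sum_{i=k}^na_ib_i\le l$) and $(u+1)v+\sum_{i=k}^na_ib_i\ge u+1$ (i.e. $v\Leftarrow\sum_{i=k}^na_ib_i\le u$). A cutting planes derivation is a sequence of steps, each being a literal axiom ($\ell\ge0$), multiplication of a constraint by a positive integer, addition of two constraints, division of a normalized constraint by a positive integer with rounding up, or saturation; constraints are identified up to normalization using $\bar x=1-x$. -}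

module Defs where

open import Data.Bool using (Bool; true; false; if_then_else_)
open import Data.Nat as ℕ using (ℕ; zero; suc; _∸_; NonZero)
import Data.Nat.Properties as ℕP
open import Data.Integer as ℤ using (ℤ; +_; -[1+_])
open import Data.List using (List; []; _∷_; map; upTo; deduplicate; length)
open import Data.Nat.ListAction using (sum)
open import Data.List.Membership.Propositional using (_∈_)
open import Data.List.Relation.Unary.Any using (Any)
open import Data.Product using (_×_; _,_; Σ; ∃; proj₁; proj₂)
open import Relation.Nullary using (yes; no)
open import Relation.Binary.PropositionalEquality using (_≡_)

-- A literal over variable 'var' : positive (x) if 'pos = true',
-- negated (x̄ = 1 - x) if 'pos = false'.
record Lit : Set where
  constructor lit
  field
    var : ℕ
    pos : Bool
open Lit public

-- A (not necessarily normalized) constraint  Σ c_j ℓ_j ≥ d  with integer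
-- coefficients c_j and literals ℓ_j.
record Constraint : Set where
  constructor _≥ᶜ_
  field
    terms : List (ℤ × Lit)
    deg   : ℤ
open Constraint public

sumℤ : List ℤ → ℤ
sumℤ []       = + 0
sumℤ (z ∷ zs) = z ℤ.+ sumℤ zs

-- Rewriting with x̄ = 1 - x, a constraint becomes  Σ_x coef x · x ≥ rhs.
coefTerm : ℕ → ℤ × Lit → ℤ
coefTerm x (c , lit y p) with x ℕ.≟ y
... | no _  = + 0
... | yes _ = if p then c else ℤ.- c

coef : Constraint → ℕ → ℤ
coef C x = sumℤ (map (coefTerm x) (terms C))

constTerm : ℤ × Lit → ℤ
constTerm (c , lit _ true)  = + 0
constTerm (c , lit _ false) = c

rhs : Constraint → ℤ
rhs C = deg C ℤ.- sumℤ (map constTerm (terms C))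

_≈ᶜ_ : Constraint → Constraint → Set
C ≈ᶜ D = (∀ x → coef C x ≡ coef D x) × rhs C ≡ rhs D

vars : Constraint → List ℕ
vars C = deduplicate ℕ._≟_ (map (λ t → var (proj₂ t)) (terms C))

normTerm : ℕ → ℤ → ℕ × Lit
normTerm x (+ n)      = (n , lit x true)
normTerm x -[1+ n ]   = (suc n , lit x false)

negPart : ℤ → ℕ
negPart (+ n)    = 0
negPart -[1+ n ] = suc n

normTerms : Constraint → List (ℕ × Lit)
normTerms C = map (λ x → normTerm x (coef C x)) (vars C)

normDeg : Constraint → ℤ
normDeg C = rhs C ℤ.+ (+ sum (map (λ x → negPart (coef C x)) (vars C)))

fromNorm : List (ℕ × Lit) → ℤ → Constraint
fromNorm ts A = map (λ t → (+ proj₁ t , proj₂ t)) ts ≥ᶜ A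

⌈_/_⌉ℕ : ℕ → (m : ℕ) → .{{NonZero m}} → ℕ
⌈ a / m ⌉ℕ = (a ℕ.+ (m ∸ 1)) ℕ./ m

⌈_/_⌉ℤ : ℤ → (m : ℕ) → .{{NonZero m}} → ℤ
⌈ + a / m ⌉ℤ      = + ⌈ a / m ⌉ℕ
⌈ -[1+ a ] / m ⌉ℤ = ℤ.- (+ (suc a ℕ./ m))

scale : ℕ → Constraint → Constraint
scale m C = map (λ t → ((+ m) ℤ.* proj₁ t , proj₂ t)) (terms C) ≥ᶜ ((+ m) ℤ.* deg C)

_⊕_ : Constraint → Constraint → Constraint
C ⊕ D = (terms C Data.List.++ terms D) ≥ᶜ (deg C ℤ.+ deg D)
  where import Data.List

divide : (m : ℕ) → .{{NonZero m}} → Constraint → Constraint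
divide m C = fromNorm (map (λ t → (⌈ proj₁ t / m ⌉ℕ , proj₂ t)) (normTerms C))
                      ⌈ normDeg C / m ⌉ℤ

-- saturation of the normalized form: a_i ↦ min(a_i, A)
-- (with A clamped at 0: for A ≤ 0 the constraint is trivial)
saturate : Constraint → Constraint
saturate C = fromNorm (map (λ t → (proj₁ t ℕ.⊓ ℤ.∣ normDeg C ℤ.⊔ + 0 ∣ , proj₂ t)) (normTerms C))
                      (normDeg C)

data Rule (Γ : List Constraint) : Constraint → Set where
  axiom : (ℓ : Lit) → Rule Γ (((+ 1 , ℓ) ∷ []) ≥ᶜ (+ 0))
  mul   : ∀ {C} → C ∈ Γ → (m : ℕ) → .{{_ : NonZero m}} → Rule Γ (scale m C)
  add   : ∀ {C D} → C ∈ Γ → D ∈ Γ → Rule Γ (C ⊕ D)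
  div   : ∀ {C} → C ∈ Γ → (m : ℕ) → .{{_ : NonZero m}} → Rule Γ (divide m C)
  sat   : ∀ {C} → C ∈ Γ → Rule Γ (saturate C)

Step : List Constraint → Constraint → Set
Step Γ D = Σ Constraint λ C → Rule Γ C × C ≈ᶜ D

data Derivation (Γ : List Constraint) : List Constraint → Set where
  done : Derivation Γ []
  step : ∀ {C Cs} → Step Γ C → Derivation (C ∷ Γ) Cs → Derivation Γ (C ∷ Cs)

DerivesIn : List Constraint → ℕ → List Constraint → Set
DerivesIn P N targets =
  ∃ λ Cs → Derivation P Cs × length Cs ≡ N
         × (∀ {T} → T ∈ targets → Any (λ C → C ≈ᶜ T) Cs)

range : ℕ → ℕ → List ℕ
range k n = map (k ℕ.+_) (upTo (suc n ∸ k))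

sumCoef : (ℕ → ℕ) → ℕ → ℕ → ℕ
sumCoef a k n = sum (map a (range k n))

evalLit : (ℕ → Bool) → Lit → ℕ
evalLit α (lit x p) with α x | p
... | true  | true  = 1
... | false | false = 1
... | _     | _     = 0

evalSum : (ℕ → ℕ) → (ℕ → Lit) → ℕ → ℕ → (ℕ → Bool) → ℕ
evalSum a b k n α = sum (map (λ i → a i ℕ.* evalLit α (b i)) (range k n))

-- defining constraints of node ⟨k,l,u⟩ with variable v:
--   ((Σ_{i=k}^n a_i) - l) v̄ - Σ_{i=k}^n a_i b_i ≥ -l
defC₁ : ℕ → (ℕ → ℕ) → (ℕ → Lit) → ℕ → ℤ → ℕ → Constraint
defC₁ n a b k l v =
  ((+ sumCoef a k n ℤ.- l , lit v false) ∷ map (λ i → (ℤ.- (+ a i) , b i)) (range k n))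
  ≥ᶜ (ℤ.- l)

defC₂ : ℕ → (ℕ → ℕ) → (ℕ → Lit) → ℕ → ℤ → ℕ → Constraint
defC₂ n a b k u v =
  ((u ℤ.+ + 1 , lit v true) ∷ map (λ i → (+ a i , b i)) (range k n))
  ≥ᶜ (u ℤ.+ + 1)

-- Adding a_i b̄_i ≥ 0 for every k′ ≤ i < k to the first defining constraint of ⟨k,l,u⟩, and
-- a_i b_i ≥ 0 to the second, gives the defining constraints of ⟨k′,l′,u⟩ up to normalization.
-- Since −a_i b_i = a_i b̄_i − a_i, the first constraint gains the terms −a_i b_i while its degree
-- drops by Σ a_i = l′ − l, and its coefficient of v̄ is unchanged because
-- Σ_{i≥k′} a_i − l′ = Σ_{i≥k} a_i − l. Each addition takes three steps: a literal axiom, a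
-- multiplication by a_i, and an addition.

module Submission where

open import Defs
open import Data.Nat using (ℕ; _≤_; _<_; _*_; _+_; _∸_; suc)
open import Data.Integer as ℤ using (ℤ; +_)
open import Data.Bool using (Bool)
open import Data.List using (_∷_; [])
open import Function.Bundles using (_⇔_)
open import Relation.Binary.PropositionalEquality using (_≢_)

open import Data.Bool using (true; false; not)
open import Data.Nat as ℕ using (zero; s≤s; z≤n; >-nonZero)
import Data.Nat.Properties as ℕP
open import Data.Nat.Tactic.RingSolver using (solve-∀)
import Data.Integer.Properties as ℤP
open import Data.Integer.Solver using (module +-*-Solver)
open import Data.List using (List; _++_; _ʳ++_; map; length; applyUpTo; upTo)
import Data.List.Properties as List
open import Data.Nat.ListAction using (sum)
open import Data.Nat.ListAction.Properties using (sum-++)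
open import Data.List.Membership.Propositional using (_∈_)
open import Data.List.Membership.Propositional.Properties using (∈-++⁻)
open import Data.List.Relation.Binary.Subset.Propositional using (_⊆_)
open import Data.List.Relation.Binary.Subset.Propositional.Properties using (∷⁺ʳ)
open import Data.List.Relation.Unary.All using (All; _∷_)
import Data.List.Relation.Unary.All.Properties as All
open import Data.List.Relation.Unary.Any using (here; there)
import Data.List.Relation.Unary.Any.Properties as Any
open import Data.Product using (_×_; _,_)
open import Data.Sum using ([_,_]′)
open import Relation.Nullary using (yes; no)
open import Function using (_∘_; id)
open import Level using (0ℓ)
open import Relation.Binary.Bundles using (Setoid)
open import Relation.Binary.PropositionalEquality
  using (_≡_; _≗_; refl; sym; trans; cong; cong₂; subst; module ≡-Reasoning)

open +-*-Solver using (solve; _:+_; _:-_; :-_; _:=_; con)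

applyUpTo-++ : ∀ {A : Set} (f : ℕ → A) m n →
               applyUpTo f (m + n) ≡ applyUpTo f m ++ applyUpTo (f ∘ (m ℕ.+_)) n
applyUpTo-++ f zero    n = refl
applyUpTo-++ f (suc m) n = cong (f 0 ∷_) (applyUpTo-++ (f ∘ suc) m n)

applyUpTo-cong : ∀ {A : Set} {f g : ℕ → A} → f ≗ g → ∀ n → applyUpTo f n ≡ applyUpTo g n
applyUpTo-cong f≗g zero    = refl
applyUpTo-cong f≗g (suc n) = cong₂ _∷_ (f≗g 0) (applyUpTo-cong (f≗g ∘ suc) n)

length-range : ∀ k n → length (range k n) ≡ suc n ∸ k
length-range k n =
  trans (List.length-map (k ℕ.+_) (upTo (suc n ∸ k))) (List.length-upTo (suc n ∸ k))

range-split : ∀ {k m n} → k ≤ suc m → m ≤ n → range k n ≡ range k m ++ range (suc m) n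
range-split {k} {m} {n} k≤1+m m≤n = begin
  range k n
    ≡⟨ List.map-upTo (k ℕ.+_) (suc n ∸ k) ⟩
  applyUpTo (k ℕ.+_) (suc n ∸ k)
    ≡⟨ cong (applyUpTo (k ℕ.+_)) length-split ⟩
  applyUpTo (k ℕ.+_) (d + e)
    ≡⟨ applyUpTo-++ (k ℕ.+_) d e ⟩
  applyUpTo (k ℕ.+_) d ++ applyUpTo (λ x → k + (d + x)) e
    ≡⟨ cong₂ _++_ (List.map-upTo (k ℕ.+_) d) (applyUpTo-cong (sym ∘ shift) e) ⟨
  range k m ++ applyUpTo (suc m ℕ.+_) e
    ≡⟨ cong (range k m ++_) (List.map-upTo (suc m ℕ.+_) e) ⟨
  range k m ++ range (suc m) n
    ∎
  where
  open ≡-Reasoning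
  d e : ℕ
  d = suc m ∸ k
  e = suc n ∸ suc m
  length-split : suc n ∸ k ≡ d + e
  length-split = begin
    suc n ∸ k        ≡⟨ cong (_∸ k) (ℕP.m∸n+n≡m (s≤s m≤n)) ⟨
    (e + suc m) ∸ k  ≡⟨ ℕP.+-∸-assoc e k≤1+m ⟩
    e + d            ≡⟨ ℕP.+-comm e d ⟩
    d + e            ∎
  shift : (λ x → k + (d + x)) ≗ (suc m ℕ.+_)
  shift x = trans (sym (ℕP.+-assoc k d x)) (cong (_+ x) (ℕP.m+[n∸m]≡n k≤1+m))

sumCoef-split : ∀ (a : ℕ → ℕ) {k m n} → k ≤ suc m → m ≤ n →
                sumCoef a k n ≡ sumCoef a k m + sumCoef a (suc m) n
sumCoef-split a {k} {m} {n} k≤1+m m≤n = begin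
  sum (map a (range k n))                     ≡⟨ cong (sum ∘ map a) (range-split k≤1+m m≤n) ⟩
  sum (map a (lower ++ upper))                ≡⟨ cong sum (List.map-++ a lower upper) ⟩
  sum (map a lower ++ map a upper)            ≡⟨ sum-++ (map a lower) (map a upper) ⟩
  sumCoef a k m + sumCoef a (suc m) n         ∎
  where
  open ≡-Reasoning
  lower upper : List ℕ
  lower = range k m
  upper = range (suc m) n

All-range⁺ : ∀ {P : ℕ → Set} {k n} → (∀ {i} → k ≤ i → i ≤ n → P i) → All P (range k n)
All-range⁺ {P} {k} {n} P-between = All.map⁺ (All.applyUpTo⁺₁ id (suc n ∸ k) P-shifted)
  where
  P-shifted : ∀ {i} → i < suc n ∸ k → P (k + i)
  P-shifted {i} i<len = P-between (ℕP.m≤m+n k i) (ℕP.≤-pred (begin-strict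
    k + i            <⟨ ℕP.+-monoʳ-< k i<len ⟩
    k + (suc n ∸ k)  ≡⟨ ℕP.m+[n∸m]≡n k≤1+n ⟩
    suc n            ∎))
    where
    open ℕP.≤-Reasoning
    k≤1+n : k ≤ suc n
    k≤1+n = ℕP.<⇒≤ (ℕP.m∸n≢0⇒n<m {suc n} {k} (ℕP.m<n⇒n≢0 i<len))

sumℤ-++ : ∀ xs ys → sumℤ (xs ++ ys) ≡ sumℤ xs ℤ.+ sumℤ ys
sumℤ-++ []       ys = sym (ℤP.+-identityˡ (sumℤ ys))
sumℤ-++ (x ∷ xs) ys =
  trans (cong (ℤ._+_ x) (sumℤ-++ xs ys)) (sym (ℤP.+-assoc x (sumℤ xs) (sumℤ ys)))

sumℤ-map-++ : ∀ {A : Set} (f : A → ℤ) xs ys →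
              sumℤ (map f (xs ++ ys)) ≡ sumℤ (map f xs) ℤ.+ sumℤ (map f ys)
sumℤ-map-++ f xs ys = trans (cong sumℤ (List.map-++ f xs ys)) (sumℤ-++ (map f xs) (map f ys))

coef-⊕ : ∀ C D x → coef (C ⊕ D) x ≡ coef C x ℤ.+ coef D x
coef-⊕ C D x = sumℤ-map-++ (coefTerm x) (terms C) (terms D)

rhs-⊕ : ∀ C D → rhs (C ⊕ D) ≡ rhs C ℤ.+ rhs D
rhs-⊕ C D = trans (cong (ℤ._-_ (deg C ℤ.+ deg D)) (sumℤ-map-++ constTerm (terms C) (terms D)))
                  (interchange (deg C) (deg D) _ _)
  where
  interchange : ∀ c d s t → (c ℤ.+ d) ℤ.- (s ℤ.+ t) ≡ (c ℤ.- s) ℤ.+ (d ℤ.- t)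
  interchange = solve 4 (λ c d s t → (c :+ d) :- (s :+ t) := (c :- s) :+ (d :- t)) refl

-- A record wrapper of _≈ᶜ_: unlike the Σ-type that _≈ᶜ_ unfolds to, it lets Agda infer the
-- constraints it relates.
record _≋_ (C D : Constraint) : Set where
  constructor ≋-intro
  field
    ≋⇒≈ᶜ : C ≈ᶜ D

open _≋_ using (≋⇒≈ᶜ)

≋-setoid : Setoid 0ℓ 0ℓ
≋-setoid = record
  { Carrier       = Constraint
  ; _≈_           = _≋_
  ; isEquivalence = record
    { refl  = ≋-intro ((λ _ → refl) , refl)
    ; sym   = λ (≋-intro (c≡ , r≡)) → ≋-intro ((sym ∘ c≡) , sym r≡)
    ; trans = λ (≋-intro (c≡ , r≡)) (≋-intro (c≡′ , r≡′)) →
                ≋-intro ((λ x → trans (c≡ x) (c≡′ x)) , trans r≡ r≡′)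
    }
  }

open Setoid ≋-setoid using ()
  renaming (refl to ≋-refl; sym to ≋-sym; trans to ≋-trans; reflexive to ≋-reflexive)

⊕-cong : ∀ {C C′ D D′} → C ≋ C′ → D ≋ D′ → (C ⊕ D) ≋ (C′ ⊕ D′)
⊕-cong {C} {C′} {D} {D′} (≋-intro (c≡ , r≡)) (≋-intro (c≡′ , r≡′)) = ≋-intro (
  (λ x → trans (coef-⊕ C D x) (trans (cong₂ ℤ._+_ (c≡ x) (c≡′ x)) (sym (coef-⊕ C′ D′ x)))) ,
  trans (rhs-⊕ C D) (trans (cong₂ ℤ._+_ r≡ r≡′) (sym (rhs-⊕ C′ D′))))

⊕-congʳ : ∀ C {D D′} → D ≋ D′ → (C ⊕ D) ≋ (C ⊕ D′)
⊕-congʳ C = ⊕-cong (≋-refl {C})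

⊕-comm : ∀ C D → (C ⊕ D) ≋ (D ⊕ C)
⊕-comm C D = ≋-intro (
  (λ x → trans (coef-⊕ C D x) (trans (ℤP.+-comm (coef C x) (coef D x)) (sym (coef-⊕ D C x)))) ,
  trans (rhs-⊕ C D) (trans (ℤP.+-comm (rhs C) (rhs D)) (sym (rhs-⊕ D C))))

⊕-assoc : ∀ C D E → ((C ⊕ D) ⊕ E) ≋ (C ⊕ (D ⊕ E))
⊕-assoc C D E = ≋-reflexive (cong₂ _≥ᶜ_ (List.++-assoc (terms C) (terms D) (terms E))
                                        (ℤP.+-assoc (deg C) (deg D) (deg E)))

⊕-swapʳ : ∀ C D E → (C ⊕ (D ⊕ E)) ≋ ((C ⊕ E) ⊕ D)
⊕-swapʳ C D E = ≋-trans (⊕-congʳ C (⊕-comm D E)) (≋-sym (⊕-assoc C E D))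

complement : Lit → Lit
complement (lit x p) = lit x (not p)

sum≥0 : (ℕ → ℕ) → (ℕ → Lit) → List ℕ → Constraint
sum≥0 a ℓ is = map (λ i → (+ a i , ℓ i)) is ≥ᶜ (+ 0)

negated-term≋complement : ∀ c ℓ →
  (((ℤ.- (+ c) , ℓ) ∷ []) ≥ᶜ (ℤ.- (+ c))) ≋ (((+ c , complement ℓ) ∷ []) ≥ᶜ (+ 0))
negated-term≋complement c (lit y p) = ≋-intro ((λ x → cong (ℤ._+ + 0) (coef≡ x p)) , rhs≡ p)
  where
  coef≡ : ∀ x p → coefTerm x (ℤ.- (+ c) , lit y p) ≡ coefTerm x (+ c , lit y (not p))
  coef≡ x p with x ℕ.≟ y | p
  ... | no _  | _     = refl
  ... | yes _ | true  = refl
  ... | yes _ | false = ℤP.neg-involutive (+ c)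
  rhs≡ : ∀ p → rhs (((ℤ.- (+ c) , lit y p) ∷ []) ≥ᶜ (ℤ.- (+ c)))
             ≡ rhs (((+ c , lit y (not p)) ∷ []) ≥ᶜ (+ 0))
  rhs≡ true  = solve 1 (λ c → (:- c) :- (con (+ 0) :+ con (+ 0))
                            := con (+ 0) :- (c :+ con (+ 0))) refl (+ c)
  rhs≡ false = solve 1 (λ c → (:- c) :- ((:- c) :+ con (+ 0))
                            := con (+ 0) :- (con (+ 0) :+ con (+ 0))) refl (+ c)

negated-terms≋complements : ∀ (a : ℕ → ℕ) (ℓ : ℕ → Lit) is →
  (map (λ i → (ℤ.- (+ a i) , ℓ i)) is ≥ᶜ (ℤ.- (+ sum (map a is))))
    ≋ sum≥0 a (complement ∘ ℓ) is
negated-terms≋complements a ℓ []       = ≋-refl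
negated-terms≋complements a ℓ (i ∷ is) = begin
  (negated i ∷ map negated is) ≥ᶜ (ℤ.- (+ (a i + sum (map a is))))
    ≡⟨ cong ((negated i ∷ map negated is) ≥ᶜ_) neg-+ ⟩
  ((negated i ∷ []) ≥ᶜ (ℤ.- (+ a i))) ⊕ (map negated is ≥ᶜ (ℤ.- (+ sum (map a is))))
    ≈⟨ ⊕-cong (negated-term≋complement (a i) (ℓ i)) (negated-terms≋complements a ℓ is) ⟩
  sum≥0 a (complement ∘ ℓ) (i ∷ is)
    ∎
  where
  open import Relation.Binary.Reasoning.Setoid ≋-setoid
  negated : ℕ → ℤ × Lit
  negated i = (ℤ.- (+ a i) , ℓ i)
  neg-+ : ℤ.- (+ (a i + sum (map a is))) ≡ ℤ.- (+ a i) ℤ.+ ℤ.- (+ sum (map a is))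
  neg-+ = trans (cong ℤ.-_ (ℤP.pos-+ (a i) _)) (ℤP.neg-distrib-+ (+ a i) _)

scale-axiom : ∀ c ℓ → scale c (((+ 1 , ℓ) ∷ []) ≥ᶜ (+ 0)) ≡ ((+ c , ℓ) ∷ []) ≥ᶜ (+ 0)
scale-axiom c ℓ = cong₂ (λ c′ d → ((c′ , ℓ) ∷ []) ≥ᶜ d) (ℤP.*-identityʳ (+ c)) (ℤP.*-zeroʳ (+ c))

Rule-mono : ∀ {Γ Δ C} → Γ ⊆ Δ → Rule Γ C → Rule Δ C
Rule-mono Γ⊆Δ (axiom ℓ)   = axiom ℓ
Rule-mono Γ⊆Δ (mul C∈ m)  = mul (Γ⊆Δ C∈) m
Rule-mono Γ⊆Δ (add C∈ D∈) = add (Γ⊆Δ C∈) (Γ⊆Δ D∈)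
Rule-mono Γ⊆Δ (div C∈ m)  = div (Γ⊆Δ C∈) m
Rule-mono Γ⊆Δ (sat C∈)    = sat (Γ⊆Δ C∈)

Derivation-mono : ∀ {Γ Δ Cs} → Γ ⊆ Δ → Derivation Γ Cs → Derivation Δ Cs
Derivation-mono Γ⊆Δ done                  = done
Derivation-mono Γ⊆Δ (step (C , r , C≈) d) =
  step (C , Rule-mono Γ⊆Δ r , C≈) (Derivation-mono (∷⁺ʳ _ Γ⊆Δ) d)

⊆-ʳ++ : ∀ {Γ : List Constraint} Cs → Γ ⊆ Cs ʳ++ Γ
⊆-ʳ++ []       = id
⊆-ʳ++ (C ∷ Cs) = ⊆-ʳ++ Cs ∘ there

_++ᵈ_ : ∀ {Γ Cs Ds} → Derivation Γ Cs → Derivation (Cs ʳ++ Γ) Ds → Derivation Γ (Cs ++ Ds)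
done     ++ᵈ e = e
step s d ++ᵈ e = step s (d ++ᵈ e)

DerivesIn-mono : ∀ {Γ Δ N Ts} → Γ ⊆ Δ → DerivesIn Γ N Ts → DerivesIn Δ N Ts
DerivesIn-mono Γ⊆Δ (Cs , d , len , found) = Cs , Derivation-mono Γ⊆Δ d , len , found

DerivesIn-++ : ∀ {Γ N M Ts Us} →
               DerivesIn Γ N Ts → DerivesIn Γ M Us → DerivesIn Γ (N + M) (Ts ++ Us)
DerivesIn-++ {Ts = Ts} (Cs , d , refl , found) (Ds , e , refl , found′) =
  Cs ++ Ds , d ++ᵈ Derivation-mono (⊆-ʳ++ Cs) e , List.length-++ Cs ,
  [ Any.++⁺ˡ ∘ found , Any.++⁺ʳ Cs ∘ found′ ]′ ∘ ∈-++⁻ Ts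

prepend : ∀ {Γ C N Ts} → Rule Γ C → DerivesIn (C ∷ Γ) N Ts → DerivesIn Γ (suc N) Ts
prepend {C = C} r (Cs , d , refl , found) =
  C ∷ Cs , step (C , r , ≋⇒≈ᶜ (≋-refl {C})) d , refl , there ∘ found

single : ∀ {Γ C T} → Rule Γ C → C ≋ T → DerivesIn Γ 1 (T ∷ [])
single {C = C} {T} r C≋T =
  T ∷ [] , step (C , r , ≋⇒≈ᶜ C≋T) done , refl , λ { (here refl) → here (≋⇒≈ᶜ (≋-refl {T})) }

DerivesIn-cast : ∀ {Γ N M Ts} → N ≡ M → DerivesIn Γ N Ts → DerivesIn Γ M Ts
DerivesIn-cast refl d = d

pad : ∀ {Γ N Ts} → Lit → DerivesIn Γ N Ts → DerivesIn Γ (suc N) Ts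
pad ℓ d = prepend (axiom ℓ) (DerivesIn-mono there d)

add-literals : ∀ {Γ C T} (a : ℕ → ℕ) (ℓ : ℕ → Lit) is →
               0 < length is → All (λ i → 0 < a i) is → C ∈ Γ → T ≋ (C ⊕ sum≥0 a ℓ is) →
               DerivesIn Γ (length is * 3) (T ∷ [])
add-literals {Γ} {C} {T} a ℓ (i ∷ is) _ (aᵢ>0 ∷ a>0) C∈Γ T≋ =
  prepend (axiom (ℓ i)) (prepend (mul (here refl) (a i) {{>-nonZero aᵢ>0}}) (continue is a>0 T≋))
  where
  open import Relation.Binary.Reasoning.Setoid ≋-setoid
  A M : Constraint
  A = ((+ 1 , ℓ i) ∷ []) ≥ᶜ (+ 0)
  M = scale (a i) A
  C⊕M≋ : (C ⊕ M) ≋ (C ⊕ sum≥0 a ℓ (i ∷ []))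
  C⊕M≋ = ⊕-congʳ C (≋-reflexive (scale-axiom (a i) (ℓ i)))
  add-M : Rule (M ∷ A ∷ Γ) (C ⊕ M)
  add-M = add (there (there C∈Γ)) (here refl)
  continue : ∀ js → All (λ j → 0 < a j) js → T ≋ (C ⊕ sum≥0 a ℓ (i ∷ js)) →
             DerivesIn (M ∷ A ∷ Γ) (suc (length js * 3)) (T ∷ [])
  continue []       _   T≋ = single add-M (≋-trans C⊕M≋ (≋-sym T≋))
  continue (j ∷ js) a>0 T≋ =
    prepend add-M
      (add-literals a ℓ (j ∷ js) (s≤s z≤n) a>0 (here refl) (begin
        T                                                  ≈⟨ T≋ ⟩
        C ⊕ (sum≥0 a ℓ (i ∷ []) ⊕ sum≥0 a ℓ (j ∷ js))      ≈⟨ ⊕-assoc C _ _ ⟨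
        (C ⊕ sum≥0 a ℓ (i ∷ [])) ⊕ sum≥0 a ℓ (j ∷ js)      ≈⟨ ⊕-cong C⊕M≋ ≋-refl ⟨
        (C ⊕ M) ⊕ sum≥0 a ℓ (j ∷ js)                       ∎))

defC₁-extend : ∀ n a b {k m} l v → k ≤ suc m → m ≤ n →
  defC₁ n a b k (l ℤ.+ + sumCoef a k m) v
    ≋ (defC₁ n a b (suc m) l v ⊕ sum≥0 a (complement ∘ b) (range k m))
defC₁-extend n a b {k} {m} l v k≤1+m m≤n = begin
  defC₁ n a b k (l ℤ.+ + P) v
    ≡⟨ cong₂ _≥ᶜ_ (cong₂ (λ c ts → (c , lit v false) ∷ ts) coef≡ terms≡) deg≡ ⟩
  head ⊕ (lower ⊕ upper)
    ≈⟨ ⊕-swapʳ head lower upper ⟩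
  (head ⊕ upper) ⊕ lower
    ≡⟨ cong (λ d → (terms (head ⊕ upper) ≥ᶜ d) ⊕ lower) (ℤP.+-identityˡ (ℤ.- l)) ⟩
  defC₁ n a b (suc m) l v ⊕ lower
    ≈⟨ ⊕-congʳ (defC₁ n a b (suc m) l v) (negated-terms≋complements a b is) ⟩
  defC₁ n a b (suc m) l v ⊕ sum≥0 a (complement ∘ b) is
    ∎
  where
  open import Relation.Binary.Reasoning.Setoid ≋-setoid
  is : List ℕ
  is = range k m
  P S : ℕ
  P = sumCoef a k m
  S = sumCoef a (suc m) n
  negated : ℕ → ℤ × Lit
  negated i = (ℤ.- (+ a i) , b i)
  head lower upper : Constraint
  head  = ((+ S ℤ.- l , lit v false) ∷ []) ≥ᶜ (+ 0)
  lower = map negated is ≥ᶜ (ℤ.- (+ P))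
  upper = map negated (range (suc m) n) ≥ᶜ (ℤ.- l)
  coef≡ : + sumCoef a k n ℤ.- (l ℤ.+ + P) ≡ + S ℤ.- l
  coef≡ = trans (cong (λ s → + s ℤ.- (l ℤ.+ + P)) (sumCoef-split a k≤1+m m≤n)) (cancel P S l)
    where
    cancel : ∀ p s l → + (p + s) ℤ.- (l ℤ.+ + p) ≡ + s ℤ.- l
    cancel p s l = trans (cong (ℤ._- (l ℤ.+ + p)) (ℤP.pos-+ p s))
                         (solve 3 (λ p s l → (p :+ s) :- (l :+ p) := s :- l) refl (+ p) (+ s) l)
  terms≡ : map negated (range k n) ≡ map negated is ++ map negated (range (suc m) n)
  terms≡ = trans (cong (map negated) (range-split k≤1+m m≤n))
                 (List.map-++ negated is (range (suc m) n))
  deg≡ : ℤ.- (l ℤ.+ + P) ≡ + 0 ℤ.+ (ℤ.- (+ P) ℤ.+ ℤ.- l)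
  deg≡ = solve 2 (λ l P → :- (l :+ P) := con (+ 0) :+ ((:- P) :+ (:- l))) refl l (+ P)

defC₂-extend : ∀ n a b {k m} u v → k ≤ suc m → m ≤ n →
  defC₂ n a b k u v ≋ (defC₂ n a b (suc m) u v ⊕ sum≥0 a b (range k m))
defC₂-extend n a b {k} {m} u v k≤1+m m≤n = begin
  defC₂ n a b k u v
    ≡⟨ cong₂ _≥ᶜ_ (cong (_ ∷_) terms≡) (sym (ℤP.+-identityʳ (u ℤ.+ + 1))) ⟩
  head ⊕ (lower ⊕ upper)
    ≈⟨ ⊕-swapʳ head lower upper ⟩
  (head ⊕ upper) ⊕ lower
    ≡⟨ cong (λ d → (terms (head ⊕ upper) ≥ᶜ d) ⊕ lower) (ℤP.+-identityʳ (u ℤ.+ + 1)) ⟩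
  defC₂ n a b (suc m) u v ⊕ sum≥0 a b is
    ∎
  where
  open import Relation.Binary.Reasoning.Setoid ≋-setoid
  is : List ℕ
  is = range k m
  term : ℕ → ℤ × Lit
  term i = (+ a i , b i)
  head lower upper : Constraint
  head  = ((u ℤ.+ + 1 , lit v true) ∷ []) ≥ᶜ (u ℤ.+ + 1)
  lower = sum≥0 a b is
  upper = map term (range (suc m) n) ≥ᶜ (+ 0)
  terms≡ : map term (range k n) ≡ map term is ++ map term (range (suc m) n)
  terms≡ = trans (cong (map term) (range-split k≤1+m m≤n))
                 (List.map-++ term is (range (suc m) n))

-- Only 6(k − k′) steps are needed; the remaining three are filled with literal axioms.
proposition7 : (n : ℕ) (a : ℕ → ℕ) (b : ℕ → Lit) →
    (∀ i → 1 ≤ i → i ≤ n → 1 ≤ a i) →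
    (∀ i j → 1 ≤ i → i ≤ n → 1 ≤ j → j ≤ n → i ≢ j → b i ≢ b j) →
    (k k′ : ℕ) (l u : ℤ) (v : ℕ) →
    1 ≤ k′ → k′ < k → k ≤ suc n →
    (∀ (α : ℕ → Bool) →
       ((+ evalSum a b k n α) ℤ.≤ u) ⇔ ((+ evalSum a b k′ n α) ℤ.≤ u)) →
    DerivesIn (defC₁ n a b k l v ∷ defC₂ n a b k u v ∷ [])
              (6 * (k ∸ k′) + 3)
              (defC₁ n a b k′ (l ℤ.+ + sumCoef a k′ (k ∸ 1)) v
                 ∷ defC₂ n a b k′ u v ∷ [])
proposition7 n a b a-pos _ zero    k′ l u v _   ()           _         _
proposition7 n a b a-pos _ (suc m) k′ l u v 1≤k′ (s≤s k′≤m) (s≤s m≤n) _ =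
  DerivesIn-cast count
    (pad (lit v true) (pad (lit v true) (pad (lit v true) (DerivesIn-++
      (add-literals a (complement ∘ b) is nonempty positive (here refl)
         (defC₁-extend n a b l v k′≤1+m m≤n))
      (add-literals a b is nonempty positive (there (here refl))
         (defC₂-extend n a b u v k′≤1+m m≤n))))))
  where
  is : List ℕ
  is = range k′ m
  k′≤1+m : k′ ≤ suc m
  k′≤1+m = ℕP.m≤n⇒m≤1+n k′≤m
  nonempty : 0 < length is
  nonempty = subst (0 <_) (sym (length-range k′ m)) (ℕP.m<n⇒0<n∸m (s≤s k′≤m))
  positive : All (λ i → 0 < a i) is
  positive = All-range⁺ (λ k′≤i i≤m → a-pos _ (ℕP.≤-trans 1≤k′ k′≤i) (ℕP.≤-trans i≤m m≤n))
  count : 3 + (length is * 3 + length is * 3) ≡ 6 * (suc m ∸ k′) + 3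
  count = trans (cong (λ L → 3 + (L * 3 + L * 3)) (length-range k′ m))
                (six-per-index (suc m ∸ k′))
    where
    six-per-index : ∀ L → 3 + (L * 3 + L * 3) ≡ 6 * L + 3
    six-per-index = solve-∀
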